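{- Let $J$, $J_1,J_2,J_3$ be as in the setting described in the context, and let $t$ be a colouring of $V(J)$ associated with $\{J_1,J_2,J_3\}$. If $C$ is a $\beta_t$-cycle with at least six vertices and $P$ is a $\beta_t$-path which has a common vertex with $C$, then each vertex of $P$ belonging to $J_2$ is a vertex of $C$.
   Context: Setting: $J$ is a $3$-connected, $2$-connected, $3$-colourable plane graph all of whose faces are bounded by $3$-cycles or $4$-cycles, and $\{J_1,J_2,J_3\}$ is a partition of $V(J)$ into three independent sets such that ($a_1$) every vertex of $J_1\cup J_2$ has degree at most $4$, and ($a_2$) if $v\in J_1$ and $v_1,v_2,v_3,v_4$ are consecutive neighbours of $v$ (in the cyclic order around $v$ in the embedding) with $v_1,v_2\in J_3$ and $v_3,v_4\in J_2$, then $v_1$ or $v_2$ has degree at most $4$. Define successively: $X_1$ = set of $v\in J_1$ with at most one neighbour in $J_3$; $X_2$ = set of $v\in J_2$ with at most one neighbour in $J_3$ and no neighbour in $X_1$; $X_3$ = set of vertices of degree $4$ having exactly two non-consecutive neighbours in $J_3$. The preliminary colouring $p:V(J)\to\{\alpha,\beta,\gamma\}$ is $p=\alpha$ on $J_3\cup X_1\cup X_2$, $p=\beta$ on $(J_1\cup J_2)\setminus(X_1\cup X_2\cup X_3)$, $p=\gamma$ on $X_3$. For a (not necessarily proper) colouring $t:V(J)\to\{\alpha,\beta,\gamma\}$, an $\alpha_t$-vertex is a vertex with $t(v)=\alpha$, and a $\beta_t$-cycle (resp. $\beta_t$-path) is a cycle (path) of $J$ all of whose vertices have colour $\beta$; similarly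 for other colours. $t$ is associated with $\{J_1,J_2,J_3\}$ if: (1) every $\beta_t$-cycle is a $\beta_p$-cycle; (2) every $\alpha_t$-vertex of $J_1$ of degree $3$ (resp. $4$) has at most one neighbour (resp. two neighbours) in $J_3$; (3) if an $\alpha_t$-vertex of $J_1$ has two neighbours in $J_3$, then none of its $\beta_t$-neighbours belongs to a $\beta_t$-cycle; (4) every $\alpha_t$-vertex of $J_2$ has at most one neighbour in $J_3$; (5) every vertex of $J_3$ is an $\alpha_t$-vertex; (6) a vertex is a $\gamma_t$-vertex iff it has degree $4$ and exactly two non-consecutive neighbours in $J_3$; (7) the set of $\alpha_t$-vertices in $J_1\cup J_2$ is independent in $J$; (8) the set of all $\alpha_t$-vertices induces a forest in $J$. -}

module Defs where

open import Data.Nat using (ℕ; zero; suc; _+_; _*_; _≤_; _<_; _≤ᵇ_)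
open import Data.Fin using (Fin; toℕ; _≟_)
open import Data.List using (List; []; _∷_; _++_; length; map; filterᵇ; concatMap; allFin; upTo; head; last; [_])
open import Data.List.Membership.Propositional using (_∈_; _∉_)
open import Data.List.Relation.Unary.All using (All)
open import Data.List.Relation.Unary.Unique.Propositional using (Unique)
open import Data.List.Relation.Unary.Linked using (Linked)
open import Data.Bool using (Bool; true; false; if_then_else_)
open import Data.Bool.ListAction using (and)
open import Data.Maybe using (just)
open import Data.Product using (Σ; ∃; ∃-syntax; _×_; _,_; proj₁)
open import Data.Sum using (_⊎_)
open import Data.Empty using (⊥)
open import Relation.Nullary using (¬_; does)
open import Relation.Binary.PropositionalEquality using (_≡_; _≢_)

-- Plane graphs as rotation systems (combinatorial embeddings).
-- Vertices are Fin n; rot v lists the neighbours of v in the cyclic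
-- (clockwise) order around v given by the embedding.

record RotSys : Set where
  field
    n          : ℕ
    rot        : Fin n → List (Fin n)
    rot-unique : ∀ v → Unique (rot v)          -- simple graph
    loopless   : ∀ v → v ∉ rot v
    symmetric  : ∀ u v → v ∈ rot u → u ∈ rot v

-- element following x in the cyclic list (h ∷ _), wrapping to h
nextAfter : ∀ {n} → Fin n → Fin n → List (Fin n) → Fin n
nextAfter h x []           = x
nextAfter h x (y ∷ [])     = if does (y ≟ x) then h else x
nextAfter h x (y ∷ z ∷ ys) = if does (y ≟ x) then z else nextAfter h x (z ∷ ys)

cycNext : ∀ {n} → List (Fin n) → Fin n → Fin n
cycNext []      x = x
cycNext (h ∷ t) x = nextAfter h x (h ∷ t)

iter : ∀ {A : Set} → (A → A) → ℕ → A → A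
iter f zero    a = a
iter f (suc k) a = f (iter f k a)

module _ (J : RotSys) where
  open RotSys J

  V : Set
  V = Fin n

  Adj : V → V → Set
  Adj u v = v ∈ rot u

  deg : V → ℕ
  deg v = length (rot v)

  Dart : Set
  Dart = V × V

  darts : List Dart
  darts = concatMap (λ u → map (u ,_) (rot u)) (allFin n)

  -- face-tracing permutation on darts
  φ : Dart → Dart
  φ (u , v) = (v , cycNext (rot v) u)

  code : Dart → ℕ
  code (u , v) = toℕ u * n + toℕ v

  -- a dart is the leader of its face if it has the least code on its orbit
  leader : Dart → Bool
  leader d = and (map (λ k → code d ≤ᵇ code (iter φ k d)) (upTo (length darts)))

  numFaces : ℕ
  numFaces = length (filterᵇ leader darts)

  Walk : V → V → List V → Set
  Walk u v P = Linked Adj P × head P ≡ just u × last P ≡ just v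

  IsPath : List V → Set
  IsPath P = P ≢ [] × Unique P × Linked Adj P

  IsCycle : List V → Set
  IsCycle C = 3 ≤ length C × Unique C ×
              ∃[ x ] ∃[ rest ] (C ≡ x ∷ rest × Linked Adj (x ∷ rest ++ [ x ]))

  Connected : Set
  Connected = ∀ u v → ∃[ P ] Walk u v P

  KConnected : ℕ → Set
  KConnected k = k < n × (∀ (S : List V) → length S < k → ∀ u v → u ∉ S → v ∉ S →
                          ∃[ P ] (Walk u v P × All (_∉ S) P))

  -- genus-0 rotation system (Euler: n - E + F = 2, with 2E = #darts)
  IsPlane : Set
  IsPlane = Connected × 2 * (n + numFaces) ≡ 4 + length darts

  FacesTriQuad : Set
  FacesTriQuad = ∀ u v → Adj u v →
    ∃[ k ] ((k ≡ 3 ⊎ k ≡ 4) × iter φ k (u , v) ≡ (u , v) ×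
            Unique (map (λ i → proj₁ (iter φ i (u , v))) (upTo k)))

  ThreeColourable : Set
  ThreeColourable = Σ (V → Fin 3) λ f → ∀ u v → Adj u v → f u ≢ f v

data Cls : Set where
  J₁ J₂ J₃ : Cls

isJ₃ : Cls → Bool
isJ₃ J₃ = true
isJ₃ _  = false

data Col : Set where
  α β γ : Col

-- list xs, read cyclically, has a , b , c , d as consecutive entries
Consec4 : {A : Set} → List A → A → A → A → A → Set
Consec4 xs a b c d = ∃[ ys ] ∃[ zs ] ∃[ ws ]
  (xs ≡ ys ++ zs × zs ++ ys ≡ a ∷ b ∷ c ∷ d ∷ ws)

module _ (J : RotSys) (part : Fin (RotSys.n J) → Cls) where
  open RotSys J

  IndepPartition : Set
  IndepPartition = ∀ u v → Adj J u v → part u ≢ part v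

  nJ₃ : V J → ℕ
  nJ₃ v = length (filterᵇ (λ w → isJ₃ (part w)) (rot v))

  InJ₃ : V J → Set
  InJ₃ v = part v ≡ J₃

  A1 : Set
  A1 = ∀ v → part v ≢ J₃ → deg J v ≤ 4

  A2 : Set
  A2 = ∀ v v₁ v₂ v₃ v₄ → part v ≡ J₁ → Consec4 (rot v) v₁ v₂ v₃ v₄ →
       part v₁ ≡ J₃ → part v₂ ≡ J₃ → part v₃ ≡ J₂ → part v₄ ≡ J₂ →
       deg J v₁ ≤ 4 ⊎ deg J v₂ ≤ 4

  X₁ : V J → Set
  X₁ v = part v ≡ J₁ × nJ₃ v ≤ 1

  X₂ : V J → Set
  X₂ v = part v ≡ J₂ × nJ₃ v ≤ 1 × (∀ w → Adj J v w → ¬ X₁ w)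

  X₃ : V J → Set
  X₃ v = ∃[ a ] ∃[ b ] ∃[ c ] ∃[ d ] (rot v ≡ a ∷ b ∷ c ∷ d ∷ [] ×
           ((InJ₃ a × InJ₃ c × ¬ InJ₃ b × ¬ InJ₃ d) ⊎
            (InJ₃ b × InJ₃ d × ¬ InJ₃ a × ¬ InJ₃ c)))

  -- p(v) = β  iff  v ∈ (J₁ ∪ J₂) ∖ (X₁ ∪ X₂ ∪ X₃)
  pβ : V J → Set
  pβ v = part v ≢ J₃ × ¬ X₁ v × ¬ X₂ v × ¬ X₃ v

  module _ (t : V J → Col) where

    IsβtCycle : List (V J) → Set
    IsβtCycle C = IsCycle J C × All (λ v → t v ≡ β) C

    record Associated : Set where
      field
        ass1 : ∀ C → IsβtCycle C → All pβ C
        ass2 : ∀ v → part v ≡ J₁ → t v ≡ α →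
                 (deg J v ≡ 3 → nJ₃ v ≤ 1) × (deg J v ≡ 4 → nJ₃ v ≤ 2)
        ass3 : ∀ v → part v ≡ J₁ → t v ≡ α → nJ₃ v ≡ 2 →
                 ∀ w → Adj J v w → t w ≡ β → ¬ (∃[ C ] (IsβtCycle C × w ∈ C))
        ass4 : ∀ v → part v ≡ J₂ → t v ≡ α → nJ₃ v ≤ 1
        ass5 : ∀ v → part v ≡ J₃ → t v ≡ α
        ass6 : ∀ v → (t v ≡ γ → X₃ v) × (X₃ v → t v ≡ γ)
        ass7 : ∀ u v → Adj J u v → t u ≡ α → t v ≡ α →
                 part u ≢ J₃ → part v ≢ J₃ → ⊥
        ass8 : ∀ C → IsCycle J C → ¬ All (λ v → t v ≡ α) C

-- Let a ∈ C have a βₜ-neighbour b off C.  Vertices of C are pβ-vertices, and a pβ-vertex of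
-- J₁ has at least two J₃-neighbours among at most four neighbours; since a already has three
-- non-J₃ neighbours (two on C, and b), a ∈ J₂ and so b ∈ J₁.  Suppose b had a second
-- βₜ-neighbour c off C.  The neighbours x, x′ of a on C lie in J₁, and each sees its two
-- C-neighbours consecutively in its rotation (it is not in X₃).  Walking around the faces
-- (triangles or quadrilaterals) at a next to the edge ab, a face through x or x′ either closes
-- a βₜ 4-cycle through b, making b a pβ-vertex with three non-J₃ neighbours, or puts a J₃-vertex
-- next to a in the rotation at b; J₃-vertices on both sides of a would put b into X₃, i.e. make
-- it a γₜ-vertex.  Degree at most 4 at a leaves no other arrangement.  Hence βₜ-paths leaving C
-- stay within J₁ ∪ C.  Only the face structure, (a₁), independence and the association axioms
-- are used, and |C| ≥ 5 suffices.

module Submission where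

open import Defs
open import Data.Nat using (ℕ; zero; suc; _+_; _≤_; _<_; z≤n; s≤s)
open import Data.Nat.Properties using (≤-trans; ≤-refl; n≤1+n; <-irrefl; +-monoˡ-≤; ≰⇒>)
open import Data.Fin using (Fin; _≟_)
open import Data.Bool using (T; T?)
open import Data.List using (List; []; _∷_; _++_; length; [_]; filterᵇ)
open import Data.List.Properties using (length-++)
open import Data.List.Membership.Propositional using (_∈_; _∉_)
open import Data.List.Membership.Propositional.Properties using (∈-filter⁻)
open import Data.List.Relation.Unary.Any using (here; there)
open import Data.List.Relation.Unary.All using (All; []; _∷_)
import Data.List.Relation.Unary.All as All
import Data.List.Relation.Unary.All.Properties as All
open import Data.List.Relation.Unary.AllPairs using ([]; _∷_)
open import Data.List.Relation.Unary.Unique.Propositional using (Unique)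
open import Data.List.Relation.Unary.Unique.Propositional.Properties using (++⁺; filter⁺)
open import Data.List.Relation.Binary.Disjoint.Propositional using (Disjoint)
open import Data.List.Relation.Unary.Linked using (Linked; [-]; _∷_)
open import Data.Product using (∃-syntax; _×_; _,_; proj₁; proj₂)
open import Data.Sum using (_⊎_; inj₁; inj₂)
open import Data.Empty using (⊥; ⊥-elim)
open import Function using (_∘_)
open import Relation.Nullary using (¬_; yes; no)
open import Relation.Unary using (Decidable)
open import Relation.Binary.Definitions using (DecidableEquality)
open import Relation.Binary.PropositionalEquality using (_≡_; _≢_; refl; sym; trans; cong; subst; ≢-sym)

-- Cyclic order of a list

-- CycStep k i j says j = i + 1 mod k; the bounds i, j < k are supplied separately.
data CycStep : ℕ → ℕ → ℕ → Set where
  step : ∀ {k i} → CycStep k i (suc i)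
  wrap : ∀ {i} → CycStep (suc i) i 0

cycStep-functional : ∀ {k i j j′} → CycStep k i j → CycStep k i j′ → j < k → j′ < k → j ≡ j′
cycStep-functional step step _ _ = refl
cycStep-functional step wrap j<k _ = ⊥-elim (<-irrefl refl j<k)
cycStep-functional wrap step _ j′<k = ⊥-elim (<-irrefl refl j′<k)
cycStep-functional wrap wrap _ _ = refl

cycStep-injective : ∀ {k i i′ j} → CycStep k i j → CycStep k i′ j → i ≡ i′
cycStep-injective step step = refl
cycStep-injective wrap wrap = refl

cycStep-noCycle₁ : ∀ {k i} → 2 ≤ k → ¬ CycStep k i i
cycStep-noCycle₁ (s≤s ()) wrap

cycStep-noCycle₂ : ∀ {k i j} → 3 ≤ k → CycStep k i j → ¬ CycStep k j i
cycStep-noCycle₂ (s≤s (s≤s ())) step wrap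
cycStep-noCycle₂ (s≤s (s≤s ())) wrap step

cycStep-noCycle₃ : ∀ {k i j l} → 4 ≤ k → CycStep k i j → CycStep k j l → ¬ CycStep k l i
cycStep-noCycle₃ (s≤s (s≤s (s≤s ()))) step step wrap
cycStep-noCycle₃ (s≤s (s≤s (s≤s ()))) step wrap step
cycStep-noCycle₃ (s≤s (s≤s (s≤s ()))) wrap step step

cycStep-noCycle₄ : ∀ {k i j l m} → 5 ≤ k →
  CycStep k i j → CycStep k j l → CycStep k l m → ¬ CycStep k m i
cycStep-noCycle₄ (s≤s (s≤s (s≤s (s≤s ())))) step step step wrap
cycStep-noCycle₄ (s≤s (s≤s (s≤s (s≤s ())))) step step wrap step
cycStep-noCycle₄ (s≤s (s≤s (s≤s (s≤s ())))) step wrap step step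
cycStep-noCycle₄ (s≤s (s≤s (s≤s (s≤s ())))) wrap step step step

module _ {A : Set} where

  data At : List A → ℕ → A → Set where
    here  : ∀ {x xs} → At (x ∷ xs) 0 x
    there : ∀ {x xs i y} → At xs i y → At (x ∷ xs) (suc i) y

  at-< : ∀ {xs i x} → At xs i x → i < length xs
  at-< here      = s≤s z≤n
  at-< (there p) = s≤s (at-< p)

  at-functional : ∀ {xs i x y} → At xs i x → At xs i y → x ≡ y
  at-functional here      here      = refl
  at-functional (there p) (there q) = at-functional p q

  at-∈ : ∀ {xs i x} → At xs i x → x ∈ xs
  at-∈ here      = here refl
  at-∈ (there p) = there (at-∈ p)

  ∈-at : ∀ {xs x} → x ∈ xs → ∃[ i ] At xs i x
  ∈-at (here refl) = 0 , here
  ∈-at (there x∈xs) with i , p ← ∈-at x∈xs = suc i , there p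

  <-at : ∀ {xs i} → i < length xs → ∃[ x ] At xs i x
  <-at {x ∷ xs} {zero}  _         = x , here
  <-at {x ∷ xs} {suc i} (s≤s i<n) with y , p ← <-at {xs} i<n = y , there p

  at-injective : ∀ {xs i j x} → Unique xs → At xs i x → At xs j x → i ≡ j
  at-injective _          here      here      = refl
  at-injective (x∉ ∷ _)   here      (there q) = ⊥-elim (All.lookup x∉ (at-∈ q) refl)
  at-injective (x∉ ∷ _)   (there p) here      = ⊥-elim (All.lookup x∉ (at-∈ p) refl)
  at-injective (_ ∷ uniq) (there p) (there q) = cong suc (at-injective uniq p q)

  at-++ˡ : ∀ {xs ys i x} → At xs i x → At (xs ++ ys) i x
  at-++ˡ here      = here
  at-++ˡ (there p) = there (at-++ˡ p)

  at-snoc : ∀ xs {x} → At (xs ++ [ x ]) (length xs) x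
  at-snoc []       = here
  at-snoc (_ ∷ xs) = there (at-snoc xs)

  data Consecutive : List A → A → A → Set where
    first : ∀ {x y xs} → Consecutive (x ∷ y ∷ xs) x y
    later : ∀ {z xs x y} → Consecutive xs x y → Consecutive (z ∷ xs) x y

  at-consecutive : ∀ {xs i x y} → At xs i x → At xs (suc i) y → Consecutive xs x y
  at-consecutive here      (there here) = first
  at-consecutive (there p) (there q)    = later (at-consecutive p q)

  linked-consecutive : ∀ {R : A → A → Set} {xs x y} → Linked R xs → Consecutive xs x y → R x y
  linked-consecutive (r ∷ _)  first     = r
  linked-consecutive (_ ∷ rs) (later c) = linked-consecutive rs c

  consecutive-snoc : ∀ xs {z x y} → Consecutive (xs ++ [ z ]) x y →
    ∃[ i ] (At xs i x × (At xs (suc i) y ⊎ (suc i ≡ length xs × y ≡ z)))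
  consecutive-snoc []           (later ())
  consecutive-snoc (_ ∷ [])     first     = 0 , here , inj₂ (refl , refl)
  consecutive-snoc (_ ∷ [])     (later (later ()))
  consecutive-snoc (_ ∷ _ ∷ _)  first     = 0 , here , inj₁ (there here)
  consecutive-snoc (_ ∷ xs@(_ ∷ _)) (later c) with consecutive-snoc xs c
  ... | i , p , inj₁ q            = suc i , there p , inj₁ (there q)
  ... | i , p , inj₂ (e , refl)  = suc i , there p , inj₂ (cong suc e , refl)

  data CycSucc : List A → A → A → Set where
    cycSucc : ∀ {x xs u v} → Consecutive (x ∷ xs ++ [ x ]) u v → CycSucc (x ∷ xs) u v

  cycSucc-at : ∀ {xs u v} → CycSucc xs u v →
    ∃[ i ] ∃[ j ] (At xs i u × At xs j v × CycStep (length xs) i j)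
  cycSucc-at {x ∷ xs} (cycSucc c) with consecutive-snoc (x ∷ xs) c
  ... | i , p , inj₁ q           = i , suc i , p , q , step
  ... | i , p , inj₂ (e , refl)  = i , 0 , p , here , subst (λ k → CycStep k i 0) e wrap

  at-cycSucc : ∀ {xs i j u v} → At xs i u → At xs j v → CycStep (length xs) i j → CycSucc xs u v
  at-cycSucc {x ∷ xs} p q    step = cycSucc (at-consecutive (at-++ˡ p) (at-++ˡ q))
  at-cycSucc {x ∷ xs} p here wrap = cycSucc (at-consecutive (at-++ˡ p) (at-snoc (x ∷ xs)))

  cycSucc-∈ˡ : ∀ {xs u v} → CycSucc xs u v → u ∈ xs
  cycSucc-∈ˡ c with _ , _ , p , _ ← cycSucc-at c = at-∈ p

  cycSucc-∈ʳ : ∀ {xs u v} → CycSucc xs u v → v ∈ xs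
  cycSucc-∈ʳ c with _ , _ , _ , q , _ ← cycSucc-at c = at-∈ q

  consecutive-snoc-successor : ∀ {xs v} z → v ∈ xs → ∃[ w ] Consecutive (xs ++ [ z ]) v w
  consecutive-snoc-successor {_ ∷ []}     z (here refl) = z , first
  consecutive-snoc-successor {_ ∷ y ∷ _}  z (here refl) = y , first
  consecutive-snoc-successor {_ ∷ _}      z (there v∈)
    with w , c ← consecutive-snoc-successor z v∈ = w , later c

  cycSucc-successor : ∀ {xs v} → v ∈ xs → ∃[ w ] CycSucc xs v w
  cycSucc-successor {x ∷ xs} v∈ with w , c ← consecutive-snoc-successor x v∈ = w , cycSucc c

  cycSucc-predecessor : ∀ {xs v} → v ∈ xs → ∃[ u ] CycSucc xs u v
  cycSucc-predecessor {x ∷ xs} v∈ with ∈-at v∈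
  ... | zero , q with u , p ← <-at {x ∷ xs} {length xs} ≤-refl = u , at-cycSucc p q wrap
  ... | suc i , q with u , p ← <-at {x ∷ xs} {i} (≤-trans (n≤1+n _) (at-< q)) = u , at-cycSucc p q step

  module _ {xs : List A} (uniq : Unique xs) where

    cycSucc-functional : ∀ {u v w} → CycSucc xs u v → CycSucc xs u w → v ≡ w
    cycSucc-functional c d
      with _ , j , p , q , s ← cycSucc-at c | _ , j′ , p′ , q′ , s′ ← cycSucc-at d
      with refl ← at-injective uniq p p′
      with refl ← cycStep-functional s s′ (at-< q) (at-< q′)
      = at-functional q q′

    cycSucc-injective : ∀ {u v w} → CycSucc xs u w → CycSucc xs v w → u ≡ v
    cycSucc-injective c d
      with _ , _ , p , q , s ← cycSucc-at c | _ , _ , p′ , q′ , s′ ← cycSucc-at d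
      with refl ← at-injective uniq q q′
      with refl ← cycStep-injective s s′
      = at-functional p p′

    cycSucc-noCycle₁ : ∀ {u} → 2 ≤ length xs → ¬ CycSucc xs u u
    cycSucc-noCycle₁ 2≤ c
      with _ , _ , p , q , s ← cycSucc-at c
      with refl ← at-injective uniq p q
      = cycStep-noCycle₁ 2≤ s

    cycSucc-noCycle₂ : ∀ {u v} → 3 ≤ length xs → CycSucc xs u v → ¬ CycSucc xs v u
    cycSucc-noCycle₂ 3≤ c d
      with _ , _ , p , q , s ← cycSucc-at c | _ , _ , p′ , q′ , s′ ← cycSucc-at d
      with refl ← at-injective uniq p q′ | refl ← at-injective uniq q p′
      = cycStep-noCycle₂ 3≤ s s′

    cycSucc-noCycle₃ : ∀ {u v w} → 4 ≤ length xs →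
      CycSucc xs u v → CycSucc xs v w → ¬ CycSucc xs w u
    cycSucc-noCycle₃ 4≤ c d e
      with _ , _ , p , q , s ← cycSucc-at c | _ , _ , p′ , q′ , s′ ← cycSucc-at d
         | _ , _ , p″ , q″ , s″ ← cycSucc-at e
      with refl ← at-injective uniq q p′ | refl ← at-injective uniq q′ p″
         | refl ← at-injective uniq q″ p
      = cycStep-noCycle₃ 4≤ s s′ s″

    cycSucc-noCycle₄ : ∀ {u v w x} → 5 ≤ length xs →
      CycSucc xs u v → CycSucc xs v w → CycSucc xs w x → ¬ CycSucc xs x u
    cycSucc-noCycle₄ 5≤ c d e f
      with _ , _ , p , q , s ← cycSucc-at c | _ , _ , p′ , q′ , s′ ← cycSucc-at d
         | _ , _ , p″ , q″ , s″ ← cycSucc-at e | _ , _ , p‴ , q‴ , s‴ ← cycSucc-at f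
      with refl ← at-injective uniq q p′ | refl ← at-injective uniq q′ p″
         | refl ← at-injective uniq q″ p‴ | refl ← at-injective uniq q‴ p
      = cycStep-noCycle₄ 5≤ s s′ s″ s‴

  remove : (xs : List A) {x : A} → x ∈ xs → List A
  remove (_ ∷ xs) (here _)    = xs
  remove (y ∷ xs) (there x∈) = y ∷ remove xs x∈

  length-remove : ∀ xs {x} (x∈ : x ∈ xs) → suc (length (remove xs x∈)) ≡ length xs
  length-remove (_ ∷ _)  (here _)    = refl
  length-remove (_ ∷ xs) (there x∈) = cong suc (length-remove xs x∈)

  ∈-remove : ∀ xs {x y} (x∈ : x ∈ xs) → y ∈ xs → x ≢ y → y ∈ remove xs x∈
  ∈-remove (_ ∷ _)  (here refl) (here refl)  x≢y = ⊥-elim (x≢y refl)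
  ∈-remove (_ ∷ _)  (here refl) (there y∈)  _   = y∈
  ∈-remove (_ ∷ _)  (there _)   (here refl)  _   = here refl
  ∈-remove (_ ∷ xs) (there x∈) (there y∈)  x≢y = there (∈-remove xs x∈ y∈ x≢y)

  unique⊆⇒length≤ : ∀ {xs} ys → Unique xs → All (_∈ ys) xs → length xs ≤ length ys
  unique⊆⇒length≤ ys []             []           = z≤n
  unique⊆⇒length≤ ys (x∉ ∷ uniq) (x∈ ∷ xs⊆) =
    subst (_ ≤_) (length-remove ys x∈) (s≤s (unique⊆⇒length≤ (remove ys x∈) uniq (shrink x∉ xs⊆)))
    where
      shrink : ∀ {zs} → All (_ ≢_) zs → All (_∈ ys) zs → All (_∈ remove ys x∈) zs
      shrink []           []           = []
      shrink (x≢z ∷ x≢s) (z∈ ∷ zs⊆) = ∈-remove ys x∈ z∈ x≢z ∷ shrink x≢s zs⊆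

  -- The shape of X₃ in Defs: X₃ J part v is AlternatingQuad (InJ₃ J part) (rot v).
  AlternatingQuad : (A → Set) → List A → Set
  AlternatingQuad Q xs = ∃[ a ] ∃[ b ] ∃[ c ] ∃[ d ] (xs ≡ a ∷ b ∷ c ∷ d ∷ [] ×
    ((Q a × Q c × ¬ Q b × ¬ Q d) ⊎ (Q b × Q d × ¬ Q a × ¬ Q c)))

  quad-alternatingQuad : ∀ {Q : A → Set} {e₀ e₁ e₂ e₃ s a m c} →
    let xs = e₀ ∷ e₁ ∷ e₂ ∷ e₃ ∷ [] in Unique xs →
    s ∈ xs → CycSucc xs s a → CycSucc xs a m → CycSucc xs m c →
    Q s → Q m → ¬ Q a → ¬ Q c → AlternatingQuad Q xs
  quad-alternatingQuad uniq (here refl) sa am mc qs qm ¬qa ¬qc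
    with refl ← cycSucc-functional uniq (cycSucc first) sa
    with refl ← cycSucc-functional uniq (cycSucc (later first)) am
    with refl ← cycSucc-functional uniq (cycSucc (later (later first))) mc
    = _ , _ , _ , _ , refl , inj₁ (qs , qm , ¬qa , ¬qc)
  quad-alternatingQuad uniq (there (here refl)) sa am mc qs qm ¬qa ¬qc
    with refl ← cycSucc-functional uniq (cycSucc (later first)) sa
    with refl ← cycSucc-functional uniq (cycSucc (later (later first))) am
    with refl ← cycSucc-functional uniq (cycSucc (later (later (later first)))) mc
    = _ , _ , _ , _ , refl , inj₂ (qs , qm , ¬qc , ¬qa)
  quad-alternatingQuad uniq (there (there (here refl))) sa am mc qs qm ¬qa ¬qc
    with refl ← cycSucc-functional uniq (cycSucc (later (later first))) sa
    with refl ← cycSucc-functional uniq (cycSucc (later (later (later first)))) am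
    with refl ← cycSucc-functional uniq (cycSucc first) mc
    = _ , _ , _ , _ , refl , inj₁ (qm , qs , ¬qc , ¬qa)
  quad-alternatingQuad uniq (there (there (there (here refl)))) sa am mc qs qm ¬qa ¬qc
    with refl ← cycSucc-functional uniq (cycSucc (later (later (later first)))) sa
    with refl ← cycSucc-functional uniq (cycSucc first) am
    with refl ← cycSucc-functional uniq (cycSucc (later first)) mc
    = _ , _ , _ , _ , refl , inj₂ (qm , qs , ¬qa , ¬qc)

  module _ (_≟_ : DecidableEquality A) {xs : List A} (uniq : Unique xs) (len≤4 : length xs ≤ 4) where

    ∈-quad : ∀ {a b c d e} → Unique (a ∷ b ∷ c ∷ d ∷ []) → All (_∈ xs) (a ∷ b ∷ c ∷ d ∷ []) →
      e ∈ xs → e ≡ a ⊎ e ≡ b ⊎ e ≡ c ⊎ e ≡ d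
    ∈-quad {a} {b} {c} {d} {e} distinct abcd⊆ e∈
      with e ≟ a | e ≟ b | e ≟ c | e ≟ d
    ... | yes e≡a | _       | _       | _       = inj₁ e≡a
    ... | no _    | yes e≡b | _       | _       = inj₂ (inj₁ e≡b)
    ... | no _    | no _    | yes e≡c | _       = inj₂ (inj₂ (inj₁ e≡c))
    ... | no _    | no _    | no _    | yes e≡d = inj₂ (inj₂ (inj₂ e≡d))
    ... | no e≢a  | no e≢b  | no e≢c  | no e≢d  = ⊥-elim (<-irrefl refl (≤-trans 5≤ len≤4))
      where
        5≤ : 5 ≤ length xs
        5≤ = unique⊆⇒length≤ xs ((e≢a ∷ e≢b ∷ e≢c ∷ e≢d ∷ []) ∷ distinct) (e∈ ∷ abcd⊆)

    length≤ : ∀ {ys} → Unique ys → All (_∈ xs) ys → length ys ≤ length xs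
    length≤ = unique⊆⇒length≤ xs

    cycSucc-quad-distinct : ∀ {p b y z} → CycSucc xs p b → CycSucc xs b y → z ∈ xs →
      z ≢ p → z ≢ b → z ≢ y → Unique (p ∷ b ∷ y ∷ z ∷ [])
    cycSucc-quad-distinct {p} {b} {y} {z} pb by z∈ z≢p z≢b z≢y =
      (p≢b ∷ p≢y ∷ ≢-sym z≢p ∷ []) ∷ (b≢y ∷ ≢-sym z≢b ∷ []) ∷ (≢-sym z≢y ∷ []) ∷ [] ∷ []
      where
        p∈ : p ∈ xs
        p∈ = cycSucc-∈ˡ pb
        b∈ : b ∈ xs
        b∈ = cycSucc-∈ʳ pb
        p≢b : p ≢ b
        p≢b refl = cycSucc-noCycle₁ uniq (length≤ ((z≢b ∷ []) ∷ [] ∷ []) (z∈ ∷ b∈ ∷ [])) pb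
        b≢y : b ≢ y
        b≢y refl = cycSucc-noCycle₁ uniq (length≤ ((z≢b ∷ []) ∷ [] ∷ []) (z∈ ∷ b∈ ∷ [])) by
        p≢y : p ≢ y
        p≢y refl = cycSucc-noCycle₂ uniq
          (length≤ ((z≢p ∷ z≢b ∷ []) ∷ (p≢b ∷ []) ∷ [] ∷ []) (z∈ ∷ p∈ ∷ b∈ ∷ [])) pb by

    cycSucc-close-quad : ∀ {p b y z} → CycSucc xs p b → CycSucc xs b y → z ∈ xs →
      z ≢ p → z ≢ b → z ≢ y → CycSucc xs y z × CycSucc xs z p
    cycSucc-close-quad {p} {b} {y} {z} pb by z∈ z≢p z≢b z≢y = yz , zp
      where
        distinct : Unique (p ∷ b ∷ y ∷ z ∷ [])
        distinct = cycSucc-quad-distinct pb by z∈ z≢p z≢b z≢y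
        pbyz⊆ : All (_∈ xs) (p ∷ b ∷ y ∷ z ∷ [])
        pbyz⊆ = cycSucc-∈ˡ pb ∷ cycSucc-∈ʳ pb ∷ cycSucc-∈ʳ by ∷ z∈ ∷ []
        4≤ : 4 ≤ length xs
        4≤ = length≤ distinct pbyz⊆
        2≤ : 2 ≤ length xs
        2≤ = ≤-trans (s≤s (s≤s z≤n)) 4≤
        3≤ : 3 ≤ length xs
        3≤ = ≤-trans (s≤s (s≤s (s≤s z≤n))) 4≤
        yz : CycSucc xs y z
        yz with w , yw ← cycSucc-successor (cycSucc-∈ʳ by)
           with ∈-quad distinct pbyz⊆ (cycSucc-∈ʳ yw)
        ... | inj₁ refl               = ⊥-elim (cycSucc-noCycle₃ uniq 4≤ pb by yw)
        ... | inj₂ (inj₁ refl)        = ⊥-elim (cycSucc-noCycle₂ uniq 3≤ by yw)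
        ... | inj₂ (inj₂ (inj₁ refl)) = ⊥-elim (cycSucc-noCycle₁ uniq 2≤ yw)
        ... | inj₂ (inj₂ (inj₂ refl)) = yw
        zp : CycSucc xs z p
        zp with w , zw ← cycSucc-successor z∈
           with ∈-quad distinct pbyz⊆ (cycSucc-∈ʳ zw)
        ... | inj₁ refl               = zw
        ... | inj₂ (inj₁ refl)        = ⊥-elim (cycSucc-noCycle₃ uniq 4≤ by yz zw)
        ... | inj₂ (inj₂ (inj₁ refl)) = ⊥-elim (cycSucc-noCycle₂ uniq 3≤ yz zw)
        ... | inj₂ (inj₂ (inj₂ refl)) = ⊥-elim (cycSucc-noCycle₁ uniq 2≤ zw)

    module _ {Q : A → Set} where

      cycSucc-alternatingQuad : ∀ {s a m c} → CycSucc xs s a → CycSucc xs a m → c ∈ xs → c ≢ a →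
        Q s → Q m → ¬ Q a → ¬ Q c → AlternatingQuad Q xs
      cycSucc-alternatingQuad {s} {a} {m} {c} sa am c∈ c≢a qs qm ¬qa ¬qc =
        shape xs uniq len≤4 4≤ (cycSucc-∈ˡ sa) sa am mc
        where
          c≢s : c ≢ s
          c≢s refl = ¬qc qs
          c≢m : c ≢ m
          c≢m refl = ¬qc qm
          mc : CycSucc xs m c
          mc = proj₁ (cycSucc-close-quad sa am c∈ c≢s c≢a c≢m)
          4≤ : 4 ≤ length xs
          4≤ = length≤ (cycSucc-quad-distinct sa am c∈ c≢s c≢a c≢m)
                 (cycSucc-∈ˡ sa ∷ cycSucc-∈ʳ sa ∷ cycSucc-∈ʳ am ∷ c∈ ∷ [])
          shape : ∀ ys → Unique ys → length ys ≤ 4 → 4 ≤ length ys → s ∈ ys →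
            CycSucc ys s a → CycSucc ys a m → CycSucc ys m c → AlternatingQuad Q ys
          shape (_ ∷ _ ∷ _ ∷ _ ∷ []) u _ _ s∈ sa′ am′ mc′ =
            quad-alternatingQuad u s∈ sa′ am′ mc′ qs qm ¬qa ¬qc
          shape (_ ∷ _ ∷ _ ∷ _ ∷ _ ∷ _) _ (s≤s (s≤s (s≤s (s≤s ())))) _ _ _ _ _
          shape (_ ∷ _ ∷ _ ∷ []) _ _ (s≤s (s≤s (s≤s ()))) _ _ _ _
          shape (_ ∷ _ ∷ []) _ _ (s≤s (s≤s ())) _ _ _ _
          shape (_ ∷ []) _ _ (s≤s ()) _ _ _ _
          shape [] _ _ () _ _ _ _

      ¬alternatingQuad⇒consecutive : Decidable Q → ∀ {a a′} → a ∈ xs → a′ ∈ xs → a ≢ a′ →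
        ¬ Q a → ¬ Q a′ → (∀ {e} → e ∈ xs → ¬ Q e → e ≡ a ⊎ e ≡ a′) → ¬ AlternatingQuad Q xs →
        CycSucc xs a a′ ⊎ CycSucc xs a′ a
      ¬alternatingQuad⇒consecutive Q? {a} {a′} a∈ a′∈ a≢a′ ¬qa ¬qa′ only-a-a′ ¬alt =
        from-successor (cycSucc-successor a∈)
        where
          irrefl : ∀ {u} → ¬ CycSucc xs u u
          irrefl = cycSucc-noCycle₁ uniq (length≤ ((a≢a′ ∷ []) ∷ [] ∷ []) (a∈ ∷ a′∈ ∷ []))
          forced : ∀ {e} → e ∈ xs → e ≢ a → e ≢ a′ → Q e
          forced {e} e∈ e≢a e≢a′ with Q? e
          ... | yes qe = qe
          ... | no ¬qe with only-a-a′ e∈ ¬qe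
          ...   | inj₁ e≡a  = ⊥-elim (e≢a e≡a)
          ...   | inj₂ e≡a′ = ⊥-elim (e≢a′ e≡a′)
          from-successor : (∃[ s ] CycSucc xs a s) → CycSucc xs a a′ ⊎ CycSucc xs a′ a
          from-successor (s , as) with s ≟ a′
          ... | yes refl = inj₁ as
          ... | no s≢a′ with m , sm ← cycSucc-successor (cycSucc-∈ʳ as) | m ≟ a′
          ...   | no m≢a′ =
            inj₂ (proj₂ (cycSucc-close-quad as sm a′∈ (≢-sym a≢a′) (≢-sym s≢a′) (≢-sym m≢a′)))
          ...   | yes refl with w , a′w ← cycSucc-successor a′∈ | w ≟ a
          ...     | yes refl = inj₂ a′w
          ...     | no w≢a = ⊥-elim (¬alt (cycSucc-alternatingQuad sm a′w a∈ a≢a′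
                      (forced (cycSucc-∈ʳ as) (λ { refl → irrefl as }) s≢a′)
                      (forced (cycSucc-∈ʳ a′w) w≢a λ { refl → irrefl a′w }) ¬qa′ ¬qa))

-- Rotation systems

module _ {n : ℕ} where

  nextAfter-consecutive : ∀ (h u : Fin n) xs → u ∈ xs → Consecutive (xs ++ [ h ]) u (nextAfter h u xs)
  nextAfter-consecutive h u (x ∷ []) (here refl) with x ≟ x
  ... | yes _  = first
  ... | no x≢x = ⊥-elim (x≢x refl)
  nextAfter-consecutive h u (x ∷ y ∷ xs) u∈ with x ≟ u
  ... | yes refl = first
  ... | no x≢u with u∈
  ...   | here x≡u = ⊥-elim (x≢u (sym x≡u))
  ...   | there u∈′ = later (nextAfter-consecutive h u (y ∷ xs) u∈′)

  cycNext-cycSucc : ∀ {xs : List (Fin n)} {u} → u ∈ xs → CycSucc xs u (cycNext xs u)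
  cycNext-cycSucc {h ∷ xs} u∈ = cycSucc (nextAfter-consecutive h _ (h ∷ xs) u∈)

  cycSucc⇒cycNext : ∀ {xs : List (Fin n)} {u v} → Unique xs → CycSucc xs u v → cycNext xs u ≡ v
  cycSucc⇒cycNext uniq uv = cycSucc-functional uniq (cycNext-cycSucc (cycSucc-∈ˡ uv)) uv

module _ (J : RotSys) where
  open RotSys J

  Turn : V J → V J → V J → Set
  Turn v u w = CycSucc (rot v) u w

  adj⇒≢ : ∀ {u v} → Adj J u v → u ≢ v
  adj⇒≢ {u} u~u refl = loopless u u~u

  turn-irrefl : ∀ {v u w x} → Adj J v u → Adj J v w → u ≢ w → ¬ Turn v x x
  turn-irrefl {v} v~u v~w u≢w =
    cycSucc-noCycle₁ (rot-unique v) (unique⊆⇒length≤ (rot v) ((u≢w ∷ []) ∷ [] ∷ []) (v~u ∷ v~w ∷ []))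

  face-tri-or-quad : FacesTriQuad J → ∀ {u v w z} → Adj J u v → Turn v u w → Turn w v z →
    z ≡ u ⊎ (Turn z w u × Turn u z v)
  face-tri-or-quad faces {u} {v} {w} {z} u~v vuw wvz
    with refl ← cycSucc⇒cycNext (rot-unique v) vuw
    with refl ← cycSucc⇒cycNext (rot-unique w) wvz
    with faces u v u~v
  ... | _ , inj₁ refl , closes , _ = inj₁ (cong proj₁ closes)
  ... | _ , inj₂ refl , closes , _ =
    inj₂ (subst (Turn z w) (cong proj₁ closes) zwz′ , subst (λ r → Turn r z v) (cong proj₁ closes) z′zv)
    where
      zwz′ : Turn z w (cycNext (rot z) w)
      zwz′ = cycNext-cycSucc (symmetric w z (cycSucc-∈ʳ wvz))
      z′zv : Turn (cycNext (rot z) w) z v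
      z′zv = subst (Turn _ z) (cong proj₂ closes) (cycNext-cycSucc (symmetric z _ (cycSucc-∈ʳ zwz′)))

-- The partition {J₁, J₂, J₃}

T-isJ₃ : ∀ {c} → T (isJ₃ c) → c ≡ J₃
T-isJ₃ {J₃} _ = refl

module _ (J : RotSys) (part : V J → Cls) where
  open RotSys J

  InJ₃? : Decidable (InJ₃ J part)
  InJ₃? v with part v
  ... | J₁ = no λ ()
  ... | J₂ = no λ ()
  ... | J₃ = yes refl

  nJ₃+nonJ₃≤deg : ∀ {v ds} → Unique ds → All (λ e → Adj J v e × ¬ InJ₃ J part e) ds →
    nJ₃ J part v + length ds ≤ deg J v
  nJ₃+nonJ₃≤deg {v} {ds} uniq ds⊆ =
    subst (_≤ deg J v) (length-++ J₃s)
      (unique⊆⇒length≤ (rot v) (++⁺ (filter⁺ isJ₃? (rot-unique v)) uniq disjoint)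
        (All.++⁺ (All.tabulate (proj₁ ∘ ∈-filter⁻ isJ₃?)) (All.map proj₁ ds⊆)))
    where
      isJ₃? : Decidable (T ∘ isJ₃ ∘ part)
      isJ₃? = T? ∘ isJ₃ ∘ part
      J₃s : List (V J)
      J₃s = filterᵇ (isJ₃ ∘ part) (rot v)
      disjoint : Disjoint J₃s ds
      disjoint (e∈J₃s , e∈ds) =
        proj₂ (All.lookup ds⊆ e∈ds) (T-isJ₃ (proj₂ (∈-filter⁻ isJ₃? {xs = rot v} e∈J₃s)))

  module _ (indep : IndepPartition J part) where

    J₁-independent : ∀ {u v} → Adj J u v → part u ≡ J₁ → part v ≡ J₁ → ⊥
    J₁-independent {u} {v} u~v u∈J₁ v∈J₁ = indep u v u~v (trans u∈J₁ (sym v∈J₁))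

    J₂-neighbour-J₁ : ∀ {u v} → part u ≡ J₂ → Adj J u v → ¬ InJ₃ J part v → part v ≡ J₁
    J₂-neighbour-J₁ {u} {v} u∈J₂ u~v v∉J₃ with part v in eq
    ... | J₁ = refl
    ... | J₂ = ⊥-elim (indep u v u~v (trans u∈J₂ (sym eq)))
    ... | J₃ = ⊥-elim (v∉J₃ refl)

  module _ (a₁ : A1 J part) where

    pβ-J₁-nonJ₃≤2 : ∀ {v e₁ e₂ e₃} → pβ J part v → part v ≡ J₁ → Unique (e₁ ∷ e₂ ∷ e₃ ∷ []) →
      ¬ All (λ e → Adj J v e × ¬ InJ₃ J part e) (e₁ ∷ e₂ ∷ e₃ ∷ [])
    pβ-J₁-nonJ₃≤2 {v} (¬J₃ , ¬X₁ , _) v∈J₁ uniq e⊆ =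
      <-irrefl refl (≤-trans (+-monoˡ-≤ 3 2≤nJ₃) (≤-trans (nJ₃+nonJ₃≤deg uniq e⊆) (a₁ v ¬J₃)))
      where
        2≤nJ₃ : 2 ≤ nJ₃ J part v
        2≤nJ₃ = ≰⇒> (λ nJ₃≤1 → ¬X₁ (v∈J₁ , nJ₃≤1))

-- Around a βₜ-cycle

module OnβCycle (J : RotSys) (faces : FacesTriQuad J) (part : V J → Cls) (indep : IndepPartition J part)
  (a₁ : A1 J part) (t : V J → Col) (ass : Associated J part t)
  (x₀ : V J) (rest : List (V J)) (C-unique : Unique (x₀ ∷ rest))
  (C-closed : Linked (Adj J) (x₀ ∷ rest ++ [ x₀ ])) (C-β : All (λ v → t v ≡ β) (x₀ ∷ rest))
  (5≤|C| : 5 ≤ length (x₀ ∷ rest)) where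
  open RotSys J
  open Associated ass
  open import Data.List.Membership.DecPropositional (_≟_ {n}) using (_∈?_)

  C : List (V J)
  C = x₀ ∷ rest

  J₃ᶜ : V J → Set
  J₃ᶜ v = ¬ InJ₃ J part v

  β⇒J₃ᶜ : ∀ {v} → t v ≡ β → J₃ᶜ v
  β⇒J₃ᶜ {v} tv≡β v∈J₃ with () ← trans (sym tv≡β) (ass5 v v∈J₃)

  3≤|C| : 3 ≤ length C
  3≤|C| = ≤-trans (s≤s (s≤s (s≤s z≤n))) 5≤|C|

  C-isβCycle : IsβtCycle J part t C
  C-isβCycle = (3≤|C| , C-unique , x₀ , rest , refl , C-closed) , C-β

  ∈C⇒pβ : ∀ {v} → v ∈ C → pβ J part v
  ∈C⇒pβ = All.lookup (ass1 C C-isβCycle)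

  ∈C⇒J₃ᶜ : ∀ {v} → v ∈ C → J₃ᶜ v
  ∈C⇒J₃ᶜ v∈C = β⇒J₃ᶜ (All.lookup C-β v∈C)

  C-adjacent : ∀ {u v} → CycSucc C u v → Adj J u v
  C-adjacent (cycSucc c) = linked-consecutive C-closed c

  ∈C-∉C : ∀ {u v} → u ∈ C → v ∉ C → u ≢ v
  ∈C-∉C u∈C v∉C refl = v∉C u∈C

  -- y is a neighbour of a on C in J₁ and y′ its other neighbour on C: being a pβ-vertex, y
  -- sees exactly a and y′ outside J₃, and sees them consecutively.
  record Flank (a y y′ : V J) : Set where
    field
      y∈C  : y ∈ C
      y′∈C : y′ ∈ C
      y∈J₁ : part y ≡ J₁
      y~a  : Adj J y a
      y~y′ : Adj J y y′
      y′≢a : y′ ≢ a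
      J₃ᶜ-neighbours : ∀ {e} → Adj J y e → J₃ᶜ e → e ≡ a ⊎ e ≡ y′
      consecutive : Turn J y a y′ ⊎ Turn J y y′ a

  flank : ∀ {a y y′} → a ∈ C → y ∈ C → y′ ∈ C → part y ≡ J₁ → Adj J y a → Adj J y y′ → y′ ≢ a →
    Flank a y y′
  flank {a} {y} {y′} a∈C y∈C y′∈C y∈J₁ y~a y~y′ y′≢a = record
    { y∈C = y∈C ; y′∈C = y′∈C ; y∈J₁ = y∈J₁ ; y~a = y~a ; y~y′ = y~y′ ; y′≢a = y′≢a
    ; J₃ᶜ-neighbours = only-a-y′
    ; consecutive = ¬alternatingQuad⇒consecutive _≟_ (rot-unique y) (a₁ y (proj₁ pβy)) (InJ₃? J part)
        y~a y~y′ (≢-sym y′≢a) (∈C⇒J₃ᶜ a∈C) (∈C⇒J₃ᶜ y′∈C) only-a-y′ (proj₂ (proj₂ (proj₂ pβy))) }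
    where
      pβy : pβ J part y
      pβy = ∈C⇒pβ y∈C
      only-a-y′ : ∀ {e} → Adj J y e → J₃ᶜ e → e ≡ a ⊎ e ≡ y′
      only-a-y′ {e} y~e e∉J₃ with e ≟ a | e ≟ y′
      ... | yes e≡a | _        = inj₁ e≡a
      ... | no _    | yes e≡y′ = inj₂ e≡y′
      ... | no e≢a  | no e≢y′  = ⊥-elim (pβ-J₁-nonJ₃≤2 J part a₁ pβy y∈J₁
              ((≢-sym y′≢a ∷ ≢-sym e≢a ∷ []) ∷ (≢-sym e≢y′ ∷ []) ∷ [] ∷ [])
              ((y~a , ∈C⇒J₃ᶜ a∈C) ∷ (y~y′ , ∈C⇒J₃ᶜ y′∈C) ∷ (y~e , e∉J₃) ∷ []))

  module _ {a y y′} (F : Flank a y y′) where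
    open Flank F

    flank-J₃-after-a : ∀ {z} → Turn J y a z → InJ₃ J part z → Turn J y y′ a
    flank-J₃-after-a yaz z∈J₃ with consecutive
    ... | inj₁ yay′ = ⊥-elim (∈C⇒J₃ᶜ y′∈C
            (subst (InJ₃ J part) (cycSucc-functional (rot-unique y) yaz yay′) z∈J₃))
    ... | inj₂ yy′a = yy′a

    flank-J₃-before-a : ∀ {z} → Turn J y z a → InJ₃ J part z → Turn J y a y′
    flank-J₃-before-a yza z∈J₃ with consecutive
    ... | inj₁ yay′ = yay′
    ... | inj₂ yy′a = ⊥-elim (∈C⇒J₃ᶜ y′∈C
            (subst (InJ₃ J part) (cycSucc-injective (rot-unique y) yza yy′a) z∈J₃))

    flank-y′ : ∀ {z} → Adj J y z → J₃ᶜ z → z ≢ a → z ≡ y′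
    flank-y′ y~z z∉J₃ z≢a with J₃ᶜ-neighbours y~z z∉J₃
    ... | inj₁ z≡a  = ⊥-elim (z≢a z≡a)
    ... | inj₂ z≡y′ = z≡y′

    y-turn-irrefl : ∀ {x} → ¬ Turn J y x x
    y-turn-irrefl = turn-irrefl J y~a y~y′ (≢-sym y′≢a)

    flank-J₃ᶜ-turn : ∀ {z} → Turn J y a z ⊎ Turn J y z a → J₃ᶜ z → z ≡ y′
    flank-J₃ᶜ-turn (inj₁ yaz) z∉J₃ = flank-y′ (cycSucc-∈ʳ yaz) z∉J₃ λ { refl → y-turn-irrefl yaz }
    flank-J₃ᶜ-turn (inj₂ yza) z∉J₃ = flank-y′ (cycSucc-∈ˡ yza) z∉J₃ λ { refl → y-turn-irrefl yza }

  module OffCycle {a b c} (a∈C : a ∈ C) (a∈J₂ : part a ≡ J₂) (b∉C : b ∉ C) (a~b : Adj J a b)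
    (tb : t b ≡ β) (b~c : Adj J b c) (tc : t c ≡ β) (c∉C : c ∉ C) where

    b~a : Adj J b a
    b~a = symmetric a b a~b

    a≢c : a ≢ c
    a≢c = ∈C-∉C a∈C c∉C

    b∈J₁ : part b ≡ J₁
    b∈J₁ = J₂-neighbour-J₁ J part indep a∈J₂ a~b (β⇒J₃ᶜ tb)

    J₁-on-C : ∀ {y} → Adj J a y → y ∈ C → part y ≡ J₁
    J₁-on-C a~y y∈C = J₂-neighbour-J₁ J part indep a∈J₂ a~y (∈C⇒J₃ᶜ y∈C)

    no-β-square : ∀ {y y′} → y ∈ C → y′ ∈ C → Adj J a y → Adj J y y′ → Adj J y′ b → y′ ≢ a → ⊥
    no-β-square {y} {y′} y∈C y′∈C a~y y~y′ y′~b y′≢a =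
      pβ-J₁-nonJ₃≤2 J part a₁ pβb b∈J₁ ((≢-sym y′≢a ∷ a≢c ∷ []) ∷ (∈C-∉C y′∈C c∉C ∷ []) ∷ [] ∷ [])
        ((b~a , ∈C⇒J₃ᶜ a∈C) ∷ (symmetric y′ b y′~b , ∈C⇒J₃ᶜ y′∈C) ∷ (b~c , β⇒J₃ᶜ tc) ∷ [])
      where
        b≢ : ∀ {v} → v ∈ C → b ≢ v
        b≢ v∈C = ≢-sym (∈C-∉C v∈C b∉C)
        β∈C : ∀ {v} → v ∈ C → t v ≡ β
        β∈C = All.lookup C-β
        square : IsβtCycle J part t (b ∷ a ∷ y ∷ y′ ∷ [])
        square = (s≤s (s≤s (s≤s z≤n))
                 , ((b≢ a∈C ∷ b≢ y∈C ∷ b≢ y′∈C ∷ []) ∷ (adj⇒≢ J a~y ∷ ≢-sym y′≢a ∷ [])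
                    ∷ (adj⇒≢ J y~y′ ∷ []) ∷ [] ∷ [])
                 , b , _ , refl , (b~a ∷ a~y ∷ y~y′ ∷ y′~b ∷ [-]))
               , (tb ∷ β∈C a∈C ∷ β∈C y∈C ∷ β∈C y′∈C ∷ [])
        pβb : pβ J part b
        pβb = All.lookup (ass1 _ square) (here refl)

    flank-after-b : ∀ {y y′} → Flank a y y′ → Turn J a b y →
      (∃[ s ] (InJ₃ J part s × Turn J b s a)) × Turn J y y′ a
    flank-after-b {y} {y′} F aby = around-y (cycSucc-successor y~a)
      where
        open Flank F
        around-y : (∃[ z ] Turn J y a z) → (∃[ s ] (InJ₃ J part s × Turn J b s a)) × Turn J y y′ a
        around-y (z , yaz) with face-tri-or-quad J faces b~a aby yaz
        ... | inj₁ refl = ⊥-elim (J₁-independent J part indep (cycSucc-∈ʳ yaz) y∈J₁ b∈J₁)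
        ... | inj₂ (zyb , bza) with InJ₃? J part z
        ...   | yes z∈J₃ = (z , z∈J₃ , bza) , flank-J₃-after-a F yaz z∈J₃
        ...   | no z∉J₃ with refl ← flank-J₃ᶜ-turn F (inj₁ yaz) z∉J₃ =
          ⊥-elim (no-β-square y∈C y′∈C (symmetric y a y~a) y~y′ (cycSucc-∈ʳ zyb) y′≢a)

    flank-before-b : ∀ {y y′} → Flank a y y′ → Turn J a y b →
      (∃[ m ] (InJ₃ J part m × Turn J b a m)) × Turn J y a y′
    flank-before-b {y} {y′} F ayb = around-b (cycSucc-successor b~a)
      where
        open Flank F
        around-b : (∃[ z ] Turn J b a z) → (∃[ m ] (InJ₃ J part m × Turn J b a m)) × Turn J y a y′
        around-b (z , baz) with face-tri-or-quad J faces y~a ayb baz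
        ... | inj₁ refl = ⊥-elim (J₁-independent J part indep (cycSucc-∈ʳ baz) b∈J₁ y∈J₁)
        ... | inj₂ (zby , yza) with InJ₃? J part z
        ...   | yes z∈J₃ = (z , z∈J₃ , baz) , flank-J₃-before-a F yza z∈J₃
        ...   | no z∉J₃ with refl ← flank-J₃ᶜ-turn F (inj₂ yza) z∉J₃ =
          ⊥-elim (no-β-square y∈C y′∈C (symmetric y a y~a) y~y′ (cycSucc-∈ˡ zby) y′≢a)

    flanks-apart : ∀ {y y′ z z′} → Flank a y y′ → Flank a z z′ → y′ ≢ z′ → ¬ Adj J z y′
    flanks-apart Fy Fz y′≢z′ z~y′ =
      y′≢z′ (flank-y′ Fz z~y′ (∈C⇒J₃ᶜ (Flank.y′∈C Fy)) (Flank.y′≢a Fy))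

    -- The J₃-vertices on either side of a in the rotation at b, together with c, put b into X₃.
    b-between-flanks : ∀ {y y′ z z′} → Flank a y y′ → Flank a z z′ → Turn J a b y → Turn J a z b → ⊥
    b-between-flanks Fy Fz aby azb
      with (s , s∈J₃ , bsa) , _ ← flank-after-b Fy aby | (m , m∈J₃ , bam) , _ ← flank-before-b Fz azb
      with () ← trans (sym tb) (proj₂ (ass6 b) (cycSucc-alternatingQuad _≟_ (rot-unique b) (a₁ b (β⇒J₃ᶜ tb))
                  {Q = InJ₃ J part} bsa bam b~c (≢-sym a≢c) s∈J₃ m∈J₃ (∈C⇒J₃ᶜ a∈C) (β⇒J₃ᶜ tc)))

    b-after-flank : ∀ {y y′ z z′ p} → Flank a y y′ → Flank a z z′ → y ≢ z → y′ ≢ z′ →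
      Turn J a b y → Turn J a p b → p ≢ z → ⊥
    b-after-flank Fy Fz y≢z y′≢z′ aby apb p≢z
      with ayz , _ ← cycSucc-close-quad _≟_ (rot-unique a) (a₁ a (∈C⇒J₃ᶜ a∈C)) apb aby
                       (symmetric _ a (Flank.y~a Fz)) (≢-sym p≢z) (∈C-∉C (Flank.y∈C Fz) b∉C) (≢-sym y≢z)
      with face-tri-or-quad J faces (symmetric _ _ (Flank.y~y′ Fy)) (proj₂ (flank-after-b Fy aby)) ayz
    ... | inj₁ refl = J₁-independent J part indep (Flank.y~y′ Fy) (Flank.y∈J₁ Fy) (Flank.y∈J₁ Fz)
    ... | inj₂ (zay′ , _) = flanks-apart Fy Fz y′≢z′ (cycSucc-∈ʳ zay′)

    b-before-flank : ∀ {y y′ z z′ q} → Flank a y y′ → Flank a z z′ → y ≢ z → y′ ≢ z′ →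
      Turn J a y b → Turn J a b q → q ≢ z → ⊥
    b-before-flank Fy Fz y≢z y′≢z′ ayb abq q≢z
      with _ , azy ← cycSucc-close-quad _≟_ (rot-unique a) (a₁ a (∈C⇒J₃ᶜ a∈C)) ayb abq
                       (symmetric _ a (Flank.y~a Fz)) (≢-sym y≢z) (∈C-∉C (Flank.y∈C Fz) b∉C) (≢-sym q≢z)
      with face-tri-or-quad J faces (Flank.y~a Fz) azy (proj₂ (flank-before-b Fy ayb))
    ... | inj₁ refl = J₁-independent J part indep (Flank.y~y′ Fy) (Flank.y∈J₁ Fy) (Flank.y∈J₁ Fz)
    ... | inj₂ (_ , zy′a) = flanks-apart Fy Fz y′≢z′ (cycSucc-∈ˡ zy′a)

    b-away-from-flanks : ∀ {x x′ p q} → Adj J a x → Adj J a x′ → x ≢ x′ → b ≢ x → b ≢ x′ →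
      Turn J a p b → Turn J a b q → p ≢ x → p ≢ x′ → q ≢ x → q ≢ x′ → ⊥
    b-away-from-flanks {p = p} {q} a~x a~x′ x≢x′ b≢x b≢x′ apb abq p≢x p≢x′ q≢x q≢x′ =
      <-irrefl refl (≤-trans 5≤deg (a₁ a (∈C⇒J₃ᶜ a∈C)))
      where
        ↛self : ∀ {v} → ¬ Turn J a v v
        ↛self = turn-irrefl J a~b a~x b≢x
        q≢p : q ≢ p
        q≢p refl = cycSucc-noCycle₂ (rot-unique a) 3≤deg apb abq
          where
            3≤deg : 3 ≤ deg J a
            3≤deg = unique⊆⇒length≤ (rot a) ((b≢x ∷ b≢x′ ∷ []) ∷ (x≢x′ ∷ []) ∷ [] ∷ []) (a~b ∷ a~x ∷ a~x′ ∷ [])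
        5≤deg : 5 ≤ deg J a
        5≤deg = unique⊆⇒length≤ (rot a)
          ((q≢p ∷ (λ { refl → ↛self abq }) ∷ q≢x ∷ q≢x′ ∷ [])
           ∷ ((λ { refl → ↛self apb }) ∷ p≢x ∷ p≢x′ ∷ []) ∷ (b≢x ∷ b≢x′ ∷ []) ∷ (x≢x′ ∷ []) ∷ [] ∷ [])
          (cycSucc-∈ʳ abq ∷ cycSucc-∈ˡ apb ∷ a~b ∷ a~x ∷ a~x′ ∷ [])

    no-second-β-neighbour : ∀ {x̃ x x′ x̃′} →
      CycSucc C x̃ x → CycSucc C x a → CycSucc C a x′ → CycSucc C x′ x̃′ → ⊥
    no-second-β-neighbour {x̃} {x} {x′} {x̃′} x̃x xa ax′ x′x̃′ =
      around-a (cycSucc-predecessor a~b) (cycSucc-successor a~b)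
      where
        a~x : Adj J a x
        a~x = symmetric x a (C-adjacent xa)
        a~x′ : Adj J a x′
        a~x′ = C-adjacent ax′
        x∈C : x ∈ C
        x∈C = cycSucc-∈ˡ xa
        x′∈C : x′ ∈ C
        x′∈C = cycSucc-∈ʳ ax′
        Fx : Flank a x x̃
        Fx = flank a∈C x∈C (cycSucc-∈ˡ x̃x) (J₁-on-C a~x x∈C) (C-adjacent xa) (symmetric x̃ x (C-adjacent x̃x))
               λ { refl → cycSucc-noCycle₂ C-unique 3≤|C| x̃x xa }
        Fx′ : Flank a x′ x̃′
        Fx′ = flank a∈C x′∈C (cycSucc-∈ʳ x′x̃′) (J₁-on-C a~x′ x′∈C) (symmetric a x′ a~x′) (C-adjacent x′x̃′)
                λ { refl → cycSucc-noCycle₂ C-unique 3≤|C| ax′ x′x̃′ }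
        x≢x′ : x ≢ x′
        x≢x′ refl = cycSucc-noCycle₂ C-unique 3≤|C| xa ax′
        x̃≢x̃′ : x̃ ≢ x̃′
        x̃≢x̃′ refl = cycSucc-noCycle₄ C-unique 5≤|C| xa ax′ x′x̃′ x̃x
        b≢x : b ≢ x
        b≢x = ≢-sym (∈C-∉C x∈C b∉C)
        b≢x′ : b ≢ x′
        b≢x′ = ≢-sym (∈C-∉C x′∈C b∉C)
        3≤deg : 3 ≤ deg J a
        3≤deg = unique⊆⇒length≤ (rot a) ((b≢x ∷ b≢x′ ∷ []) ∷ (x≢x′ ∷ []) ∷ [] ∷ []) (a~b ∷ a~x ∷ a~x′ ∷ [])
        around-a : (∃[ p ] Turn J a p b) → (∃[ q ] Turn J a b q) → ⊥
        around-a (p , apb) (q , abq) with q ≟ x | q ≟ x′ | p ≟ x | p ≟ x′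
        ... | yes refl | _        | _        | yes refl = b-between-flanks Fx Fx′ abq apb
        ... | yes refl | _        | yes refl | _        = cycSucc-noCycle₂ (rot-unique a) 3≤deg apb abq
        ... | yes refl | _        | no _     | no p≢x′  = b-after-flank Fx Fx′ x≢x′ x̃≢x̃′ abq apb p≢x′
        ... | no _     | yes refl | yes refl | _        = b-between-flanks Fx′ Fx abq apb
        ... | no _     | yes refl | no _     | yes refl = cycSucc-noCycle₂ (rot-unique a) 3≤deg apb abq
        ... | no _     | yes refl | no p≢x   | no _     =
          b-after-flank Fx′ Fx (≢-sym x≢x′) (≢-sym x̃≢x̃′) abq apb p≢x
        ... | no _     | no q≢x′  | yes refl | _        = b-before-flank Fx Fx′ x≢x′ x̃≢x̃′ apb abq q≢x′
        ... | no q≢x   | no _     | no _     | yes refl =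
          b-before-flank Fx′ Fx (≢-sym x≢x′) (≢-sym x̃≢x̃′) apb abq q≢x
        ... | no q≢x   | no q≢x′  | no p≢x   | no p≢x′  =
          b-away-from-flanks {p = p} {q} a~x a~x′ x≢x′ b≢x b≢x′ apb abq p≢x p≢x′ q≢x q≢x′

  off-C-β-neighbour : ∀ {a b} → a ∈ C → b ∉ C → Adj J a b → t b ≡ β →
    part b ≡ J₁ × (∀ {c} → Adj J b c → t c ≡ β → c ∈ C)
  off-C-β-neighbour {a} {b} a∈C b∉C a~b tb
    with x , xa ← cycSucc-predecessor a∈C | x′ , ax′ ← cycSucc-successor a∈C
    with x̃ , x̃x ← cycSucc-predecessor (cycSucc-∈ˡ xa) | x̃′ , x′x̃′ ← cycSucc-successor (cycSucc-∈ʳ ax′)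
    = J₂-neighbour-J₁ J part indep a∈J₂ a~b (β⇒J₃ᶜ tb) , stays-on-C
    where
      x≢x′ : x ≢ x′
      x≢x′ refl = cycSucc-noCycle₂ C-unique 3≤|C| xa ax′
      a∉J₁ : part a ≢ J₁
      a∉J₁ a∈J₁ = pβ-J₁-nonJ₃≤2 J part a₁ (∈C⇒pβ a∈C) a∈J₁
        ((x≢x′ ∷ ∈C-∉C (cycSucc-∈ˡ xa) b∉C ∷ []) ∷ (∈C-∉C (cycSucc-∈ʳ ax′) b∉C ∷ []) ∷ [] ∷ [])
        ((symmetric x a (C-adjacent xa) , ∈C⇒J₃ᶜ (cycSucc-∈ˡ xa)) ∷ (C-adjacent ax′ , ∈C⇒J₃ᶜ (cycSucc-∈ʳ ax′))
         ∷ (a~b , β⇒J₃ᶜ tb) ∷ [])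
      a∈J₂ : part a ≡ J₂
      a∈J₂ with part a in eq
      ... | J₁ = ⊥-elim (a∉J₁ eq)
      ... | J₂ = refl
      ... | J₃ = ⊥-elim (∈C⇒J₃ᶜ a∈C eq)
      stays-on-C : ∀ {c} → Adj J b c → t c ≡ β → c ∈ C
      stays-on-C {c} b~c tc with c ∈? C
      ... | yes c∈C = c∈C
      ... | no c∉C = ⊥-elim (OffCycle.no-second-β-neighbour a∈C a∈J₂ b∉C a~b tb b~c tc c∉C x̃x xa ax′ x′x̃′)

  Anchored : V J → Set
  Anchored v = v ∈ C ⊎ (part v ≡ J₁ × (∀ {c} → Adj J v c → t c ≡ β → c ∈ C))

  anchored-step : ∀ {u v} → Anchored u → Adj J u v → t v ≡ β → Anchored v
  anchored-step {v = v} (inj₁ u∈C) u~v tv with v ∈? C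
  ... | yes v∈C = inj₁ v∈C
  ... | no v∉C  = inj₂ (off-C-β-neighbour u∈C v∉C u~v tv)
  anchored-step (inj₂ (_ , stays-on-C)) u~v tv = inj₁ (stays-on-C u~v tv)

  anchored-path : ∀ {P w} → Linked (Adj J) P → All (λ v → t v ≡ β) P → w ∈ P → Anchored w → All Anchored P
  anchored-path {_ ∷ []}    _           _            (here refl) anchored = anchored ∷ []
  anchored-path {_ ∷ _ ∷ _} (p~r ∷ lnk) (_ ∷ tr ∷ tP) (here refl) anchored =
    anchored ∷ anchored-path lnk (tr ∷ tP) (here refl) (anchored-step anchored p~r tr)
  anchored-path {p ∷ _ ∷ _} (p~r ∷ lnk) (tp ∷ tP)    (there w∈) anchored
    with anchored-r ∷ rest-anchored ← anchored-path lnk tP w∈ anchored =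
    anchored-step anchored-r (symmetric p _ p~r) tp ∷ anchored-r ∷ rest-anchored

  J₂-on-β-path-⊆C : ∀ {P} → Linked (Adj J) P → All (λ v → t v ≡ β) P → (∃[ x ] (x ∈ C × x ∈ P)) →
    ∀ {v} → v ∈ P → part v ≡ J₂ → v ∈ C
  J₂-on-β-path-⊆C P-linked P-β (x , x∈C , x∈P) v∈P v∈J₂
    with All.lookup (anchored-path P-linked P-β x∈P (inj₁ x∈C)) v∈P
  ... | inj₁ v∈C = v∈C
  ... | inj₂ (v∈J₁ , _) with () ← trans (sym v∈J₁) v∈J₂

corollary4p1 : (J : RotSys) → IsPlane J → FacesTriQuad J →
    KConnected J 3 → KConnected J 2 → ThreeColourable J →
    (part : V J → Cls) → IndepPartition J part → A1 J part → A2 J part →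
    (t : V J → Col) → Associated J part t →
    (C : List (V J)) → IsβtCycle J part t C → 6 ≤ length C →
    (P : List (V J)) → IsPath J P → All (λ v → t v ≡ β) P →
    (∃[ x ] (x ∈ C × x ∈ P)) →
    ∀ v → v ∈ P → part v ≡ J₂ → v ∈ C
corollary4p1 J _ faces _ _ _ part indep a₁ _ t ass .(x₀ ∷ rest)
  ((_ , C-unique , x₀ , rest , refl , C-closed) , C-β) 6≤|C| P (_ , _ , P-linked) P-β meets v v∈P =
  OnβCycle.J₂-on-β-path-⊆C J faces part indep a₁ t ass x₀ rest C-unique C-closed C-β
    (≤-trans (n≤1+n 5) 6≤|C|) P-linked P-β meets v∈P
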